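{- For an integer $n\ge 2$ let $$A_n=\Big\{(x_1,\dots,x_n)\in\mathbb{Z}^n:\ n\ge x_1\ge x_2\ge\cdots\ge x_n\ge 0,\ \sum_{i=1}^k x_i\le 2n+6k-16 \text{ for all } k\in\{1,\dots,n\},\ \text{and } \sum_{i=1}^n x_i\le 6n-12\Big\},$$ and let $S_n(x_1,\dots,x_n)=\sum_{1\le i<j\le n}x_ix_j^2$. There is an absolute constant $C$ such that for every $n\ge 2$: if $(x_1,\dots,x_n)\in A_n$ maximizes $S_n$ over $A_n$ and $x_1=n$, then $S_n(x_1,\dots,x_n)\le n^3+Cn^2$. -}

module Defs where

open import Data.Nat as ℕ using (ℕ; zero; suc)
open import Data.Integer using (ℤ; +_; _+_; _*_; _-_; _≤_)
open import Data.Fin as F using (Fin; toℕ)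
open import Data.Product using (_×_)
open import Relation.Nullary using (yes; no)

∑ : ∀ {n} → (Fin n → ℤ) → ℤ
∑ {zero}  f = + 0
∑ {suc n} f = f F.zero + ∑ (λ i → f (F.suc i))

-- Prefix sum x_1 + ... + x_k (1-based), i.e. sum of x over 0-based indices i < k.
prefix : ∀ {n} → (Fin n → ℤ) → ℕ → ℤ
prefix {zero}  x k       = + 0
prefix {suc n} x zero    = + 0
prefix {suc n} x (suc k) = x F.zero + prefix (λ i → x (F.suc i)) k

-- Membership in A_n; vectors are 0-indexed: x i stands for x_{i+1}.
InA : (n : ℕ) → (Fin n → ℤ) → Set
InA n x =
    (∀ (i : Fin n) → x i ≤ + n)
  × (∀ (i j : Fin n) → i F.< j → x j ≤ x i)
  × (∀ (i : Fin n) → + 0 ≤ x i)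
  × (∀ (k : ℕ) → 1 ℕ.≤ k → k ℕ.≤ n →
       prefix x k ≤ (+ (2 ℕ.* n) + + (6 ℕ.* k)) - + 16)
  × (∑ x ≤ + (6 ℕ.* n) - + 12)

Sterm : ∀ {n} → (Fin n → ℤ) → Fin n → Fin n → ℤ
Sterm x i j with toℕ i ℕ.<? toℕ j
... | yes _ = x i * (x j * x j)
... | no _  = + 0

S : ∀ {n} → (Fin n → ℤ) → ℤ
S x = ∑ (λ i → ∑ (λ j → Sterm x i j))

IsMaximizer : (n : ℕ) → (Fin n → ℤ) → Set
IsMaximizer n x = InA n x × (∀ (y : Fin n → ℤ) → InA n y → S y ≤ S x)

-- Since S x = Σⱼ xⱼ² (x₀ + ⋯ + xⱼ₋₁) and x₀ = n, each square is weighted by n plus the sum T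
-- of the tail entries before it.  After k tail entries with sum T and pairwise-product sum W,
-- the potential  slack k T W = 2n² + 30kn − (nT + W)  satisfies the telescoping identity
--   (n + T) v² + v · slack (k+1) (T + v) (W + vT) = 30 n v + v · slack k T W,
-- and the prefix constraint T ≤ n + 6k together with 2W ≤ T² keeps it nonnegative.  So the part
-- of S after the entries n, u₁, u₂ is at most 30 n Σ + u₂ · slack 2 (u₁ + u₂) (u₁ u₂), and a
-- polynomial estimate using u₂ ≤ u₁ ≤ n, u₁ + u₂ ≤ n + 12 and Σ ≤ 5n finishes.
module Submission where

open import Defs
open import Data.Nat using (ℕ; _≥_)
open import Data.Fin using (Fin; toℕ)
open import Data.Integer using (ℤ; +_; _+_; _*_; _≤_)
open import Data.Product using (∃)
open import Relation.Binary.PropositionalEquality using (_≡_)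

import Data.Nat as ℕ
import Data.Nat.Properties as ℕP
open import Data.Nat using (z≤n; s≤s)
open import Data.Integer using (_-_; +≤+)
import Data.Integer.Properties as ℤP
import Data.Fin as F
open import Data.Fin using (zero; suc)
open import Data.Vec.Functional using (_∷_; tail)
open import Data.Product using (_,_)
open import Data.Empty using (⊥-elim)
open import Relation.Binary.PropositionalEquality using (refl; sym; trans; cong; cong₂; subst; subst₂)
open import Relation.Nullary using (yes; no)
open import Data.Integer.Tactic.RingSolver using (solve-∀)

∑-cong : ∀ {m} {f g : Fin m → ℤ} → (∀ i → f i ≡ g i) → ∑ f ≡ ∑ g
∑-cong {ℕ.zero}  f≗g = refl
∑-cong {ℕ.suc m} f≗g = cong₂ _+_ (f≗g zero) (∑-cong (λ i → f≗g (suc i)))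

∑-*ˡ : ∀ {m} c (f : Fin m → ℤ) → ∑ (λ i → c * f i) ≡ c * ∑ f
∑-*ˡ {ℕ.zero}  c f = sym (ℤP.*-zeroʳ c)
∑-*ˡ {ℕ.suc m} c f =
  trans (cong (_+_ (c * f zero)) (∑-*ˡ c (λ i → f (suc i))))
        (sym (ℤP.*-distribˡ-+ c (f zero) _))

∑² : ∀ {m} → (Fin m → ℤ) → ℤ
∑² v = ∑ (λ i → v i * v i)

prefix-zero : ∀ {m} (v : Fin m → ℤ) → prefix v 0 ≡ + 0
prefix-zero {ℕ.zero}  v = refl
prefix-zero {ℕ.suc m} v = refl

Sterm-zeroʳ : ∀ {m} (x : Fin (ℕ.suc m) → ℤ) i → Sterm x i zero ≡ + 0
Sterm-zeroʳ x i with toℕ i ℕ.<? 0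
... | no _ = refl

Sterm-zero-suc : ∀ {m} (x : Fin (ℕ.suc m) → ℤ) j →
                 Sterm x zero (suc j) ≡ x zero * (x (suc j) * x (suc j))
Sterm-zero-suc x j with 0 ℕ.<? ℕ.suc (toℕ j)
... | yes _  = refl
... | no 0≮j = ⊥-elim (0≮j (s≤s z≤n))

Sterm-suc-suc : ∀ {m} (x : Fin (ℕ.suc m) → ℤ) i j → Sterm x (suc i) (suc j) ≡ Sterm (tail x) i j
Sterm-suc-suc x i j with ℕ.suc (toℕ i) ℕ.<? ℕ.suc (toℕ j) | toℕ i ℕ.<? toℕ j
... | yes _ | yes _ = refl
... | no _  | no _  = refl
... | yes p | no q  = ⊥-elim (q (ℕ.s≤s⁻¹ p))
... | no p  | yes q = ⊥-elim (p (s≤s q))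

S-head-tail : ∀ {m} (x : Fin (ℕ.suc m) → ℤ) → S x ≡ x zero * ∑² (tail x) + S (tail x)
S-head-tail x = cong₂ _+_ firstRow laterRows
  where
  firstRow : ∑ (Sterm x zero) ≡ x zero * ∑² (tail x)
  firstRow = trans (cong₂ _+_ (Sterm-zeroʳ x zero)
                              (trans (∑-cong (Sterm-zero-suc x)) (∑-*ˡ (x zero) (tail (λ j → x j * x j)))))
                   (ℤP.+-identityˡ _)
  laterRows : ∑ (λ i → ∑ (Sterm x (suc i))) ≡ S (tail x)
  laterRows = ∑-cong λ i → trans (cong₂ _+_ (Sterm-zeroʳ x (suc i)) (∑-cong (Sterm-suc-suc x i)))
                                 (ℤP.+-identityˡ _)

S-merge : ∀ {m} (x : Fin (ℕ.suc (ℕ.suc m)) → ℤ) →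
          S x ≡ x zero * (x (suc zero) * x (suc zero)) + S ((x zero + x (suc zero)) ∷ tail (tail x))
S-merge x = begin
  S x                                          ≡⟨ S-head-tail x ⟩
  a * (b * b + ∑² v) + S (tail x)              ≡⟨ cong (_+_ (a * (b * b + ∑² v))) (S-head-tail (tail x)) ⟩
  a * (b * b + ∑² v) + (b * ∑² v + S v)        ≡⟨ regroup a b (∑² v) (S v) ⟩
  a * (b * b) + ((a + b) * ∑² v + S v)         ≡⟨ cong (_+_ (a * (b * b))) (sym (S-head-tail ((a + b) ∷ v))) ⟩
  a * (b * b) + S ((a + b) ∷ v)                ∎
  where
  open Relation.Binary.PropositionalEquality.≡-Reasoning
  a = x zero
  b = x (suc zero)
  v = tail (tail x)
  regroup : ∀ a b q s → a * (b * b + q) + (b * q + s) ≡ a * (b * b) + ((a + b) * q + s)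
  regroup = solve-∀

0≤+ : ∀ {a b} → + 0 ≤ a → + 0 ≤ b → + 0 ≤ a + b
0≤+ = ℤP.+-mono-≤

0≤* : ∀ {a b} → + 0 ≤ a → + 0 ≤ b → + 0 ≤ a * b
0≤* {+ a} {+ b} _ _ = subst (+ 0 ≤_) (ℤP.pos-* a b) (+≤+ z≤n)

0≤ℕ : ∀ k → + 0 ≤ + k
0≤ℕ k = +≤+ z≤n

0≤- : ∀ {a b} → a ≤ b → + 0 ≤ b - a
0≤- = ℤP.i≤j⇒0≤j-i

≤-by-difference : ∀ {a b} d → b - a ≡ d → + 0 ≤ d → a ≤ b
≤-by-difference d b-a≡d 0≤d = ℤP.0≤i-j⇒j≤i (subst (+ 0 ≤_) (sym b-a≡d) 0≤d)

*-monoʳ-≤-0≤ : ∀ {c a b} → + 0 ≤ c → a ≤ b → a * c ≤ b * c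
*-monoʳ-≤-0≤ {+ c} _ = ℤP.*-monoʳ-≤-nonNeg (+ c)

module _ (n : ℕ) where
  private
    N : ℤ
    N = + n

  slack : ℕ → ℤ → ℤ → ℤ
  slack k T W = (+ 2 * (N * N) + + 30 * (+ k * N)) - (N * T + W)

  slack-nonneg : ∀ k T W → k ℕ.≤ n → + 0 ≤ T → T ≤ N + + 6 * + k → + 2 * W ≤ T * T →
                 + 0 ≤ slack k T W
  slack-nonneg k T W k≤n 0≤T T≤N+6k 2W≤T² =
    ℤP.*-cancelˡ-≤-pos (+ 0) (slack k T W) (+ 2)
      (≤-by-difference _ (twice N (+ k) T W)
        (0≤+ (0≤+ (0≤+ (0≤+ (0≤* (0≤ℕ n) (0≤ℕ n))
                            (0≤* (0≤* (0≤ℕ 36) (0≤ℕ k)) (0≤- (+≤+ k≤n))))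
                       (0≤* (0≤* (0≤ℕ 2) (0≤ℕ n)) (0≤- T≤N+6k)))
                  (0≤* (0≤- T≤N+6k) (0≤+ (0≤+ (0≤ℕ n) (0≤* (0≤ℕ 6) (0≤ℕ k))) 0≤T)))
             (0≤- 2W≤T²)))
    where
    twice : ∀ N K T W →
      + 2 * ((+ 2 * (N * N) + + 30 * (K * N)) - (N * T + W)) - + 2 * + 0
      ≡ N * N + + 36 * K * (N - K) + + 2 * N * ((N + + 6 * K) - T)
        + ((N + + 6 * K) - T) * ((N + + 6 * K) + T) + (T * T - + 2 * W)
    twice = solve-∀

  slack-telescopes : ∀ k T W v₀ σ →
    (N + T) * (v₀ * v₀) + (+ 30 * N * σ + v₀ * slack (ℕ.suc k) (T + v₀) (W + v₀ * T))
      ≡ + 30 * N * (v₀ + σ) + v₀ * slack k T W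
  slack-telescopes k T W v₀ σ = telescope N T W v₀ σ (+ k)
    where
    telescope : ∀ N T W v₀ σ K →
      (N + T) * (v₀ * v₀) + (+ 30 * N * σ
        + v₀ * ((+ 2 * (N * N) + + 30 * ((+ 1 + K) * N)) - (N * (T + v₀) + (W + v₀ * T))))
      ≡ + 30 * N * (v₀ + σ) + v₀ * ((+ 2 * (N * N) + + 30 * (K * N)) - (N * T + W))
    telescope = solve-∀

  initial-prefix-bound : ∀ {r} (v : Fin r → ℤ) k T →
    (∀ j → j ℕ.≤ r → T + prefix v j ≤ N + + 6 * (+ k + + j)) → T ≤ N + + 6 * + k
  initial-prefix-bound v k T pre =
    subst₂ _≤_ (trans (cong (_+_ T) (prefix-zero v)) (ℤP.+-identityʳ T))
               (cong (λ j → N + + 6 * + j) (ℕP.+-identityʳ k)) (pre 0 z≤n)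

  S-≤-slack : ∀ {r} (v : Fin r → ℤ) (k : ℕ) (T W p : ℤ) →
    + 0 ≤ T → + 2 * W ≤ T * T → + 0 ≤ p → (∀ i → v i ≤ p) →
    (∀ i j → i F.< j → v j ≤ v i) → (∀ i → + 0 ≤ v i) →
    (∀ j → j ℕ.≤ r → T + prefix v j ≤ N + + 6 * (+ k + + j)) → k ℕ.+ r ℕ.≤ n →
    S ((N + T) ∷ v) ≤ + 30 * N * ∑ v + p * slack k T W
  S-≤-slack {ℕ.zero} v k T W p 0≤T 2W≤T² 0≤p v≤p v↓ 0≤v pre k≤n =
    0≤+ (0≤* (0≤* (0≤ℕ 30) (0≤ℕ n)) ℤP.≤-refl)
        (0≤* 0≤p (slack-nonneg k T W (ℕP.≤-trans (ℕP.m≤m+n k 0) k≤n) 0≤T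
                               (initial-prefix-bound v k T pre) 2W≤T²))
  S-≤-slack {ℕ.suc r} v k T W p 0≤T 2W≤T² 0≤p v≤p v↓ 0≤v pre k+r≤n = begin
    S ((N + T) ∷ v)
      ≡⟨ S-merge ((N + T) ∷ v) ⟩
    (N + T) * (v₀ * v₀) + S ((N + T + v₀) ∷ v′)
      ≡⟨ cong (λ a → (N + T) * (v₀ * v₀) + S (a ∷ v′)) (ℤP.+-assoc N T v₀) ⟩
    (N + T) * (v₀ * v₀) + S ((N + (T + v₀)) ∷ v′)
      ≤⟨ ℤP.+-monoʳ-≤ ((N + T) * (v₀ * v₀)) step ⟩
    (N + T) * (v₀ * v₀) + (+ 30 * N * ∑ v′ + v₀ * slack (ℕ.suc k) (T + v₀) (W + v₀ * T))
      ≡⟨ slack-telescopes k T W v₀ (∑ v′) ⟩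
    + 30 * N * ∑ v + v₀ * slack k T W
      ≤⟨ ℤP.+-monoʳ-≤ (+ 30 * N * ∑ v) (*-monoʳ-≤-0≤ 0≤slack (v≤p zero)) ⟩
    + 30 * N * ∑ v + p * slack k T W ∎
    where
    open ℤP.≤-Reasoning
    0≤slack : + 0 ≤ slack k T W
    0≤slack = slack-nonneg k T W (ℕP.≤-trans (ℕP.m≤m+n k (ℕ.suc r)) k+r≤n) 0≤T
                           (initial-prefix-bound v k T pre) 2W≤T²
    v₀ = v zero
    v′ = tail v
    squares : ∀ T W v₀ → (T + v₀) * (T + v₀) - + 2 * (W + v₀ * T) ≡ (T * T - + 2 * W) + v₀ * v₀
    squares = solve-∀
    step : S ((N + (T + v₀)) ∷ v′) ≤ + 30 * N * ∑ v′ + v₀ * slack (ℕ.suc k) (T + v₀) (W + v₀ * T)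
    step = S-≤-slack v′ (ℕ.suc k) (T + v₀) (W + v₀ * T) v₀
      (0≤+ 0≤T (0≤v zero))
      (≤-by-difference _ (squares T W v₀) (0≤+ (0≤- 2W≤T²) (0≤* (0≤v zero) (0≤v zero))))
      (0≤v zero)
      (λ i → v↓ zero (suc i) (s≤s z≤n))
      (λ i j i<j → v↓ (suc i) (suc j) (s≤s i<j))
      (λ i → 0≤v (suc i))
      (λ j j≤r → subst₂ _≤_ (sym (ℤP.+-assoc T v₀ (prefix v′ j)))
                            (cong (λ m → N + + 6 * + m) (ℕP.+-suc k j)) (pre (ℕ.suc j) (s≤s j≤r)))
      (subst (ℕ._≤ n) (ℕP.+-suc k r) k+r≤n)

  -- This is where the constant 212 comes from.
  first-entries-bound : ∀ u₁ u₂ σ → u₁ ≤ N → u₂ ≤ u₁ → u₁ + u₂ ≤ N + + 12 →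
    N + (u₁ + (u₂ + σ)) ≤ + 6 * N - + 12 →
    N * (u₁ * u₁) + ((N + u₁) * (u₂ * u₂) + (+ 30 * N * σ + u₂ * slack 2 (u₁ + u₂) (u₁ * u₂)))
      ≤ N * N * N + + 212 * (N * N)
  first-entries-bound u₁ u₂ σ u₁≤N u₂≤u₁ u₁+u₂≤N+12 sum≤ =
    ≤-by-difference _ (difference N u₁ u₂ σ)
      (0≤+ (0≤+ (0≤+ (0≤+ (0≤+ (0≤* (0≤ℕ 50) (0≤* 0≤N 0≤N))
                               (0≤* (0≤* 0≤N 0≤N) (0≤- u₁+u₂≤N+12)))
                          (0≤* (0≤* 0≤N (0≤- u₁≤N)) (0≤- u₂≤u₁)))
                     (0≤* (0≤* (0≤ℕ 30) 0≤N) (0≤- u₂≤u₁)))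
                (0≤* (0≤ℕ 360) 0≤N))
           (0≤* (0≤* (0≤ℕ 30) 0≤N) (0≤- sum≤)))
    where
    0≤N = 0≤ℕ n
    difference : ∀ N u₁ u₂ σ →
      (N * N * N + + 212 * (N * N))
        - (N * (u₁ * u₁) + ((N + u₁) * (u₂ * u₂) + (+ 30 * N * σ
            + u₂ * ((+ 2 * (N * N) + + 30 * (+ 2 * N)) - (N * (u₁ + u₂) + u₁ * u₂)))))
      ≡ + 50 * (N * N) + N * N * ((N + + 12) - (u₁ + u₂)) + N * (N - u₁) * (u₁ - u₂)
        + + 30 * N * (u₁ - u₂) + + 360 * N + + 30 * N * ((+ 6 * N - + 12) - (N + (u₁ + (u₂ + σ))))
    difference = solve-∀

prefix-constraint : ∀ {n} {x : Fin n → ℤ} → InA n x → ∀ k → 1 ℕ.≤ k → k ℕ.≤ n →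
                    prefix x k ≤ (+ 2 * + n + + 6 * + k) - + 16
prefix-constraint {n} {x} (_ , _ , _ , pre , _) k 1≤k k≤n =
  subst (λ b → prefix x k ≤ b - + 16) (cong₂ _+_ (ℤP.pos-* 2 n) (ℤP.pos-* 6 k)) (pre k 1≤k k≤n)

S-bound-two : ∀ (x : Fin 2 → ℤ) → InA 2 x → x zero ≡ + 2 → S x ≤ + 2 * + 2 * + 2 + + 212 * (+ 2 * + 2)
S-bound-two x (x≤n , _ , 0≤x , _) x₀≡2 = begin
  S x                                 ≡⟨ S-merge x ⟩
  x zero * (u₁ * u₁) + + 0            ≡⟨ cong (λ a → a * (u₁ * u₁) + + 0) x₀≡2 ⟩
  + 2 * (u₁ * u₁) + + 0               ≤⟨ ≤-by-difference _ (difference u₁) (0≤+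
                                           (0≤* (0≤* (0≤ℕ 2) (0≤- (x≤n (suc zero)))) (0≤+ (0≤ℕ 2) (0≤x (suc zero))))
                                           (0≤ℕ 848)) ⟩
  + 2 * + 2 * + 2 + + 212 * (+ 2 * + 2) ∎
  where
  open ℤP.≤-Reasoning
  u₁ = x (suc zero)
  difference : ∀ u → (+ 2 * + 2 * + 2 + + 212 * (+ 2 * + 2)) - (+ 2 * (u * u) + + 0)
                     ≡ + 2 * (+ 2 - u) * (+ 2 + u) + + 848
  difference = solve-∀

S-bound-≥3 : ∀ m (x : Fin (3 ℕ.+ m) → ℤ) → InA (3 ℕ.+ m) x → x zero ≡ + (3 ℕ.+ m) →
             S x ≤ + (3 ℕ.+ m) * + (3 ℕ.+ m) * + (3 ℕ.+ m) + + 212 * (+ (3 ℕ.+ m) * + (3 ℕ.+ m))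
S-bound-≥3 m x x∈A@(x≤n , x↓ , 0≤x , _ , sum≤) x₀≡N = begin
  S x
    ≡⟨ S-merge x ⟩
  x₀ * (u₁ * u₁) + S ((x₀ + u₁) ∷ tail (tail x))
    ≡⟨ cong (_+_ (x₀ * (u₁ * u₁))) (S-merge ((x₀ + u₁) ∷ tail (tail x))) ⟩
  x₀ * (u₁ * u₁) + ((x₀ + u₁) * (u₂ * u₂) + S (x₀ + u₁ + u₂ ∷ v))
    ≡⟨ cong (λ a → a * (u₁ * u₁) + ((a + u₁) * (u₂ * u₂) + S (a + u₁ + u₂ ∷ v))) x₀≡N ⟩
  N * (u₁ * u₁) + ((N + u₁) * (u₂ * u₂) + S (N + u₁ + u₂ ∷ v))
    ≡⟨ cong (λ a → N * (u₁ * u₁) + ((N + u₁) * (u₂ * u₂) + S (a ∷ v))) (ℤP.+-assoc N u₁ u₂) ⟩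
  N * (u₁ * u₁) + ((N + u₁) * (u₂ * u₂) + S (N + (u₁ + u₂) ∷ v))
    ≤⟨ ℤP.+-monoʳ-≤ (N * (u₁ * u₁)) (ℤP.+-monoʳ-≤ ((N + u₁) * (u₂ * u₂)) tail-bound) ⟩
  N * (u₁ * u₁) + ((N + u₁) * (u₂ * u₂) + (+ 30 * N * ∑ v + u₂ * slack n 2 (u₁ + u₂) (u₁ * u₂)))
    ≤⟨ first-entries-bound n u₁ u₂ (∑ v) (x≤n (suc zero)) (x↓ (suc zero) (suc (suc zero)) (s≤s (s≤s z≤n)))
         u₁+u₂≤N+12 total-bound ⟩
  N * N * N + + 212 * (N * N) ∎
  where
  open ℤP.≤-Reasoning
  n = 3 ℕ.+ m
  N = + n
  x₀ = x zero
  u₁ = x (suc zero)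
  u₂ = x (suc (suc zero))
  v : Fin m → ℤ
  v = tail (tail (tail x))
  tail-prefix : ∀ j → j ℕ.≤ m → u₁ + u₂ + prefix v j ≤ N + + 6 * (+ 2 + + j)
  tail-prefix j j≤m = ≤-by-difference _ (difference N (+ j) u₁ u₂ (prefix v j))
    (0≤+ (0≤- (subst (λ a → a + (u₁ + (u₂ + prefix v j)) ≤ _) x₀≡N
                     (prefix-constraint x∈A (3 ℕ.+ j) (s≤s z≤n) (s≤s (s≤s (s≤s j≤m))))))
         (0≤ℕ 10))
    where
    difference : ∀ N J u₁ u₂ P → (N + + 6 * (+ 2 + J)) - ((u₁ + u₂) + P)
      ≡ (((+ 2 * N + + 6 * (+ 3 + J)) - + 16) - (N + (u₁ + (u₂ + P)))) + + 10
    difference = solve-∀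
  u₁+u₂≤N+12 : u₁ + u₂ ≤ N + + 12
  u₁+u₂≤N+12 = subst (_≤ N + + 12) (trans (cong (_+_ (u₁ + u₂)) (prefix-zero v)) (ℤP.+-identityʳ _))
                     (tail-prefix 0 z≤n)
  total-bound : N + (u₁ + (u₂ + ∑ v)) ≤ + 6 * N - + 12
  total-bound = subst₂ (λ a b → a + (u₁ + (u₂ + ∑ v)) ≤ b - + 12) x₀≡N (ℤP.pos-* 6 n) sum≤
  squares : ∀ a b → (a + b) * (a + b) - + 2 * (a * b) ≡ a * a + b * b
  squares = solve-∀
  tail-bound : S (N + (u₁ + u₂) ∷ v) ≤ + 30 * N * ∑ v + u₂ * slack n 2 (u₁ + u₂) (u₁ * u₂)
  tail-bound = S-≤-slack n v 2 (u₁ + u₂) (u₁ * u₂) u₂ (0≤+ (0≤x _) (0≤x _))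
    (≤-by-difference _ (squares u₁ u₂) (0≤+ (0≤* (0≤x _) (0≤x _)) (0≤* (0≤x _) (0≤x _))))
    (0≤x _)
    (λ i → x↓ _ _ (s≤s (s≤s (s≤s z≤n))))
    (λ i j i<j → x↓ _ _ (s≤s (s≤s (s≤s i<j))))
    (λ i → 0≤x _)
    tail-prefix
    (ℕP.n≤1+n (2 ℕ.+ m))

lemma3 : ∃ λ (C : ℤ) → ∀ (n : ℕ) → n ≥ 2 → (x : Fin n → ℤ) → IsMaximizer n x → (∀ (i : Fin n) → toℕ i ≡ 0 → x i ≡ + n) → S x ≤ (+ n * + n * + n) + C * (+ n * + n)
lemma3 = + 212 , bound
  where
  bound : ∀ n → n ≥ 2 → (x : Fin n → ℤ) → IsMaximizer n x → (∀ i → toℕ i ≡ 0 → x i ≡ + n) →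
          S x ≤ + n * + n * + n + + 212 * (+ n * + n)
  bound ℕ.zero                  () x _ _
  bound (ℕ.suc ℕ.zero)          (s≤s ()) x _ _
  bound (ℕ.suc (ℕ.suc ℕ.zero))  _ x (x∈A , _) x₀≡n = S-bound-two x x∈A (x₀≡n zero refl)
  bound (ℕ.suc (ℕ.suc (ℕ.suc m))) _ x (x∈A , _) x₀≡n = S-bound-≥3 m x x∈A (x₀≡n zero refl)
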